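{- Let $\Delta = \Delta(\mathcal{X})$ be the EM simplex on a family $\mathcal{X} = (X_0,\ldots,X_d)$ of finite sets, and let $v(t) = \sum_{x\in\cup\mathcal{X}} t^{\#\epsilon(x)}$. Then for all integers $i\ge 0$, ${\rm Vol}_i(\Delta) = v^{(i)}(1)$, where $v^{(i)}$ is the $i$th derivative of $v$.
   Context: Let $d \geq 0$ and $\mathcal{X} = (X_0, \ldots, X_d)$ a family of finite sets (repetitions allowed; vertices indexed by $0,\dots,d$). Write $\cup\mathcal{X} = \bigcup_i X_i$ and $\deg_{\mathcal{X}}(x) = \#\{i : x \in X_i\}$. The abstract $d$-simplex $\Delta(\mathcal{X})$ has as faces all subsets $\mathcal{F}$ of $\{X_0,\dots,X_d\}$ (including $\varnothing$), $\dim\mathcal{F}=\#\mathcal{F}-1$; a cofacet of $\mathcal{F}$ is a face $\mathcal{G}\supset\mathcal{F}$ with $\#\mathcal{G}=\#\mathcal{F}+1$. Define $\epsilon(x) = \{X_i : x \in X_i\}$ if $\deg_{\mathcal{X}}(x)\le (d+1)/2$ and $\epsilon(x) = \{X_i : x \notin X_i\}$ if $\deg_{\mathcal{X}}(x)> (d+1)/2$. Labelings: for faces with $\dim \mathcal{F}\le\lfloor(d-1)/2\rfloor$, $\lambda^{(0)}(\mathcal{F}) = \{x : \epsilon(x) = \mathcal{F}\}$; for faces with $\dim\mathcal{F} \le \lfloor (d-1)/2\rfloor - (i+1)$, $\lambda^{(i+1)}(\mathcal{F})$ is the multiset union of $\lambda^{(i)}(\mathcal{G})$ over all cofacets $\mathcal{G}$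 of $\mathcal{F}$. The EM simplex is $\Delta(\mathcal{X})$ with these labelings, and ${\rm Vol}_i(\Delta) = \sum_{\mathcal{F}} |\lambda^{(i)}(\mathcal{F})|$ (multiset cardinalities), summed over faces with $\dim\mathcal{F}\le\lfloor(d-1)/2\rfloor - i$ (an empty sum being $0$). -}

module Defs where

open import Data.Nat using (ℕ; zero; suc; _+_; _*_; _∸_; _≤ᵇ_; _≤?_; _/_)
open import Data.Bool using (Bool; true; false; not; if_then_else_)
open import Data.Bool.Properties using () renaming (_≟_ to _≟ᵇ_)
open import Data.Fin using (Fin)
open import Data.Fin.Subset using (Subset; ∣_∣)
open import Data.Vec using (Vec; []; _∷_; lookup; tabulate; _[_]≔_)
open import Data.Vec.Properties using (≡-dec)
open import Data.Bool.ListAction using (any)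
open import Data.Nat.ListAction using (sum)
open import Data.List using (List; []; _∷_; map; filter; filterᵇ; length; foldr; concatMap; replicate; _++_; allFin)
open import Function using (_∘_)

-- Ground set: the elements of ∪𝒳 live in Fin n; a family 𝒳 = (X_0,…,X_d)
-- is a function Fin (suc d) → Subset n (repetitions allowed).
Family : ℕ → ℕ → Set
Family d n = Fin (suc d) → Subset n

inUnion : ∀ {d n} → Family d n → Fin n → Bool
inUnion {d} X x = any (λ i → lookup (X i) x) (allFin (suc d))

unionList : ∀ {d n} → Family d n → List (Fin n)
unionList {n = n} X = filterᵇ (inUnion X) (allFin n)

deg : ∀ {d n} → Family d n → Fin n → ℕ
deg {d} X x = length (filterᵇ (λ i → lookup (X i) x) (allFin (suc d)))

-- ε(x) as a face (subset of the vertex index set {0,…,d}).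
-- deg ≤ (d+1)/2  ⇔  2·deg ≤ d+1.
epsilon : ∀ {d n} → Family d n → Fin n → Subset (suc d)
epsilon {d} X x =
  tabulate (λ i → if (2 * deg X x) ≤ᵇ suc d
                  then lookup (X i) x
                  else not (lookup (X i) x))

-- all faces of Δ(𝒳): all subsets of the index set (including ∅)
allSubsets : (m : ℕ) → List (Subset m)
allSubsets zero = [] ∷ []
allSubsets (suc m) = map (false ∷_) (allSubsets m) ++ map (true ∷_) (allSubsets m)

cofacets : ∀ {m} → Subset m → List (Subset m)
cofacets {m} F = map (λ j → F [ j ]≔ true) (filterᵇ (λ j → not (lookup F j)) (allFin m))

-- labelings λ^(i), as multisets (lists) of elements of ∪𝒳
lam : ∀ {d n} → Family d n → ℕ → Subset (suc d) → List (Fin n)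
lam X zero F = filter (λ x → ≡-dec _≟ᵇ_ (epsilon X x) F) (unionList X)
lam X (suc i) F = concatMap (lam X i) (cofacets F)

-- Vol_i(Δ) = Σ |λ^(i)(F)| over faces F with dim F ≤ ⌊(d-1)/2⌋ - i,
-- i.e. (#F - 1) ≤ ⌊(d-1)/2⌋ - i  ⇔  #F + i ≤ ⌊(d+1)/2⌋.
Vol : ∀ {d n} → Family d n → ℕ → ℕ
Vol {d} X i =
  sum (map (λ F → length (lam X i F))
           (filter (λ F → (∣ F ∣ + i) ≤? (suc d / 2)) (allSubsets (suc d))))

-- Polynomials with ℕ coefficients as coefficient lists [c₀, c₁, …]
Poly : Set
Poly = List ℕ

_⊕_ : Poly → Poly → Poly
[] ⊕ q = q
(a ∷ p) ⊕ [] = a ∷ p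
(a ∷ p) ⊕ (b ∷ q) = (a + b) ∷ (p ⊕ q)

monomial : ℕ → Poly
monomial k = replicate k 0 ++ (1 ∷ [])

derivAux : ℕ → Poly → Poly
derivAux k [] = []
derivAux k (c ∷ cs) = (k * c) ∷ derivAux (suc k) cs

deriv : Poly → Poly
deriv [] = []
deriv (c ∷ cs) = derivAux 1 cs

derivN : ℕ → Poly → Poly
derivN zero p = p
derivN (suc i) p = derivN i (deriv p)

evalAt1 : Poly → ℕ
evalAt1 = sum

vpoly : ∀ {d n} → Family d n → Poly
vpoly X = foldr (λ x p → monomial ∣ epsilon X x ∣ ⊕ p) [] (unionList X)

-- An element of |λ⁽ⁱ⁾(F)| is an x ∈ ∪𝒳 together with a chain F = F₀ ⋖ F₁ ⋖ ⋯ ⋖ Fᵢ = ε(x)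
-- of cofacet steps, which forces |ε(x)| = |F| + i.  Double counting the first step,
-- Σ_F Σ_{G ⋖-above F} w(G) = Σ_G |G| w(G), so the number of chains of length i + 1
-- ending at E is (|E| − i) times the number of length i: it is the falling factorial
-- |E|(|E| − 1)⋯(|E| − i + 1), which is also the i-th derivative of t^|E| at 1.
-- Since |ε(x)| ≤ (d+1)/2, every chain starts at a face of dimension at most
-- ⌊(d−1)/2⌋ − i, so the dimension cutoff in Vol_i discards nothing.

module Submission where

open import Defs
open import Data.Nat using (ℕ; zero; suc; _+_; _*_; _∸_; _≤_; _<_; _≤ᵇ_; _/_)
open import Data.Nat.Properties
open import Data.Nat.DivMod using (/-monoˡ-≤; m*n/n≡m)
open import Data.Nat.Combinatorics.Base using (_P′_)
open import Data.Nat.ListAction using (sum)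
open import Data.Nat.ListAction.Properties using (sum-++)
open import Data.Bool using (Bool; true; false; not; if_then_else_)
open import Data.Bool.Properties using () renaming (_≟_ to _≟ᵇ_)
open import Data.Fin using (Fin) renaming (zero to fzero; suc to fsuc)
open import Data.Fin.Subset using (Subset; ∣_∣; ∁)
open import Data.Fin.Subset.Properties using (∣∁p∣≡n∸∣p∣; ∣p∣≤n)
open import Data.Vec using ([]; _∷_; lookup; tabulate; _[_]≔_)
open import Data.Vec.Properties using (≡-dec; tabulate-∘)
open import Data.List as List using (List; []; _∷_; map; filter; filterᵇ; length; foldr; concatMap; replicate; _++_; allFin)
open import Data.List.Properties using (length-++; map-++; map-∘; map-cong; map-cong-local; map-tabulate)
open import Data.List.Relation.Unary.All using (All; []; _∷_)
import Data.List.Relation.Unary.All as All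
open import Data.List.Relation.Unary.All.Properties using (map⁺)
open import Relation.Nullary using (yes; no; does; ¬_; contradiction)
open import Relation.Nullary.Reflects using (ofʸ; ofⁿ)
open import Relation.Unary using (Pred; Decidable)
open import Relation.Binary.PropositionalEquality
open import Function using (_∘_; id)
open import Level using (Level)
import Algebra.Properties.CommutativeSemigroup as CommutativeSemigroupProperties
open CommutativeSemigroupProperties +-commutativeSemigroup using (interchange)
  renaming (x∙yz≈y∙xz to +-left-comm)
open CommutativeSemigroupProperties *-commutativeSemigroup using ()
  renaming (x∙yz≈y∙xz to *-left-comm)

private
  variable
    A B : Set
    ℓ : Level
    m : ℕ

sumMap : (A → ℕ) → List A → ℕ
sumMap f xs = sum (map f xs)

sumMap-++ : (f : A → ℕ) (xs ys : List A) → sumMap f (xs ++ ys) ≡ sumMap f xs + sumMap f ys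
sumMap-++ f xs ys = trans (cong sum (map-++ f xs ys)) (sum-++ (map f xs) (map f ys))

sumMap-map : (f : B → ℕ) (g : A → B) (xs : List A) → sumMap f (map g xs) ≡ sumMap (f ∘ g) xs
sumMap-map f g xs = cong sum (sym (map-∘ xs))

sumMap-cong : {f g : A → ℕ} → (∀ x → f x ≡ g x) → (xs : List A) → sumMap f xs ≡ sumMap g xs
sumMap-cong f≗g xs = cong sum (map-cong f≗g xs)

sumMap-cong-local : {f g : A → ℕ} {xs : List A} → All (λ x → f x ≡ g x) xs → sumMap f xs ≡ sumMap g xs
sumMap-cong-local eqs = cong sum (map-cong-local eqs)

sumMap-zero : (xs : List A) → sumMap (λ _ → 0) xs ≡ 0
sumMap-zero [] = refl
sumMap-zero (x ∷ xs) = sumMap-zero xs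

sumMap-+ : (f g : A → ℕ) (xs : List A) → sumMap (λ x → f x + g x) xs ≡ sumMap f xs + sumMap g xs
sumMap-+ f g [] = refl
sumMap-+ f g (x ∷ xs) = trans (cong (f x + g x +_) (sumMap-+ f g xs)) (interchange (f x) (g x) _ _)

sumMap-*ˡ : (c : ℕ) (f : A → ℕ) (xs : List A) → sumMap (λ x → c * f x) xs ≡ c * sumMap f xs
sumMap-*ˡ c f [] = sym (*-zeroʳ c)
sumMap-*ˡ c f (x ∷ xs) = trans (cong (c * f x +_) (sumMap-*ˡ c f xs)) (sym (*-distribˡ-+ c (f x) _))

sumMap-swap : (f : A → B → ℕ) (xs : List A) (ys : List B) →
  sumMap (λ x → sumMap (f x) ys) xs ≡ sumMap (λ y → sumMap (λ x → f x y) xs) ys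
sumMap-swap f [] ys = sym (sumMap-zero ys)
sumMap-swap f (x ∷ xs) ys =
  trans (cong (sumMap (f x) ys +_) (sumMap-swap f xs ys))
        (sym (sumMap-+ (f x) (λ y → sumMap (λ x → f x y) xs) ys))

sumMap-filter : {P : Pred A ℓ} (P? : Decidable P) (f : A → ℕ) (xs : List A) →
  (∀ x → ¬ P x → f x ≡ 0) → sumMap f (filter P? xs) ≡ sumMap f xs
sumMap-filter P? f [] _ = refl
sumMap-filter P? f (x ∷ xs) f≡0 with P? x
... | yes _ = cong (f x +_) (sumMap-filter P? f xs f≡0)
... | no ¬px = trans (sumMap-filter P? f xs f≡0) (cong (_+ sumMap f xs) (sym (f≡0 x ¬px)))

length-filter : {P : Pred A ℓ} (P? : Decidable P) (xs : List A) →
  length (filter P? xs) ≡ sumMap (λ x → if does (P? x) then 1 else 0) xs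
length-filter P? [] = refl
length-filter P? (x ∷ xs) with does (P? x)
... | true = cong suc (length-filter P? xs)
... | false = length-filter P? xs

length-concatMap : (f : A → List B) (xs : List A) → length (concatMap f xs) ≡ sumMap (length ∘ f) xs
length-concatMap f [] = refl
length-concatMap f (x ∷ xs) = trans (length-++ (f x)) (cong (length (f x) +_) (length-concatMap f xs))

⊕-identityʳ : (p : Poly) → p ⊕ [] ≡ p
⊕-identityʳ [] = refl
⊕-identityʳ (a ∷ p) = refl

evalAt1-⊕ : (p q : Poly) → evalAt1 (p ⊕ q) ≡ evalAt1 p + evalAt1 q
evalAt1-⊕ [] q = refl
evalAt1-⊕ (a ∷ p) [] = sym (+-identityʳ _)
evalAt1-⊕ (a ∷ p) (b ∷ q) = trans (cong (a + b +_) (evalAt1-⊕ p q)) (interchange a b (sum p) (sum q))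

derivAux-⊕ : (k : ℕ) (p q : Poly) → derivAux k (p ⊕ q) ≡ derivAux k p ⊕ derivAux k q
derivAux-⊕ k [] q = refl
derivAux-⊕ k (a ∷ p) [] = sym (⊕-identityʳ _)
derivAux-⊕ k (a ∷ p) (b ∷ q) = cong₂ _∷_ (*-distribˡ-+ k a b) (derivAux-⊕ (suc k) p q)

deriv-⊕ : (p q : Poly) → deriv (p ⊕ q) ≡ deriv p ⊕ deriv q
deriv-⊕ [] q = refl
deriv-⊕ (a ∷ p) [] = sym (⊕-identityʳ _)
deriv-⊕ (a ∷ p) (b ∷ q) = derivAux-⊕ 1 p q

derivN-⊕ : (i : ℕ) (p q : Poly) → derivN i (p ⊕ q) ≡ derivN i p ⊕ derivN i q
derivN-⊕ zero p q = refl
derivN-⊕ (suc i) p q = trans (cong (derivN i) (deriv-⊕ p q)) (derivN-⊕ i (deriv p) (deriv q))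

derivN-[] : (i : ℕ) → derivN i [] ≡ []
derivN-[] zero = refl
derivN-[] (suc i) = derivN-[] i

P′-suc : (n k : ℕ) → suc n P′ suc k ≡ suc n * (n P′ k)
P′-suc n zero = refl
P′-suc n (suc k) = trans (cong ((n ∸ k) *_) (P′-suc n k)) (*-left-comm (n ∸ k) (suc n) (n P′ k))

scaledMonomial : ℕ → ℕ → Poly
scaledMonomial c k = replicate k 0 ++ (c ∷ [])

derivAux-scaledMonomial : (m c k : ℕ) → derivAux m (scaledMonomial c k) ≡ scaledMonomial ((m + k) * c) k
derivAux-scaledMonomial m c zero = cong (λ n → n * c ∷ []) (sym (+-identityʳ m))
derivAux-scaledMonomial m c (suc k) =
  cong₂ _∷_ (*-zeroʳ m)
    (trans (derivAux-scaledMonomial (suc m) c k) (cong (λ n → scaledMonomial (n * c) k) (sym (+-suc m k))))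

evalAt1-scaledMonomial : (c k : ℕ) → evalAt1 (scaledMonomial c k) ≡ c
evalAt1-scaledMonomial c zero = +-identityʳ c
evalAt1-scaledMonomial c (suc k) = evalAt1-scaledMonomial c k

evalAt1-derivN-scaledMonomial : (i c k : ℕ) → evalAt1 (derivN i (scaledMonomial c k)) ≡ (k P′ i) * c
evalAt1-derivN-scaledMonomial zero c k = trans (evalAt1-scaledMonomial c k) (sym (+-identityʳ c))
evalAt1-derivN-scaledMonomial (suc i) c zero =
  trans (cong evalAt1 (derivN-[] i)) (cong (λ n → n * (0 P′ i) * c) (sym (0∸n≡0 i)))
evalAt1-derivN-scaledMonomial (suc i) c (suc k) = begin
  evalAt1 (derivN i (derivAux 1 (scaledMonomial c k)))  ≡⟨ cong (evalAt1 ∘ derivN i) (derivAux-scaledMonomial 1 c k) ⟩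
  evalAt1 (derivN i (scaledMonomial (suc k * c) k))     ≡⟨ evalAt1-derivN-scaledMonomial i (suc k * c) k ⟩
  (k P′ i) * (suc k * c)                                ≡⟨ *-left-comm (k P′ i) (suc k) c ⟩
  suc k * ((k P′ i) * c)                                ≡⟨ *-assoc (suc k) (k P′ i) c ⟨
  suc k * (k P′ i) * c                                  ≡⟨ cong (_* c) (P′-suc k i) ⟨
  (suc k P′ suc i) * c                                  ∎
  where open ≡-Reasoning

evalAt1-derivN-sumMonomials : (g : A → ℕ) (i : ℕ) (xs : List A) →
  evalAt1 (derivN i (foldr (λ x p → monomial (g x) ⊕ p) [] xs)) ≡ sumMap (λ x → g x P′ i) xs
evalAt1-derivN-sumMonomials g i [] = cong evalAt1 (derivN-[] i)
evalAt1-derivN-sumMonomials g i (x ∷ xs) = begin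
  evalAt1 (derivN i (monomial (g x) ⊕ p))                 ≡⟨ cong evalAt1 (derivN-⊕ i (monomial (g x)) p) ⟩
  evalAt1 (derivN i (monomial (g x)) ⊕ derivN i p)        ≡⟨ evalAt1-⊕ (derivN i (monomial (g x))) (derivN i p) ⟩
  evalAt1 (derivN i (monomial (g x))) + evalAt1 (derivN i p)
    ≡⟨ cong₂ _+_ (trans (evalAt1-derivN-scaledMonomial i 1 (g x)) (*-identityʳ _))
                 (evalAt1-derivN-sumMonomials g i xs) ⟩
  g x P′ i + sumMap (λ x → g x P′ i) xs                   ∎
  where
  open ≡-Reasoning
  p = foldr (λ x p → monomial (g x) ⊕ p) [] xs

sumMap-allSubsets : (f : Subset (suc m) → ℕ) →
  sumMap f (allSubsets (suc m)) ≡ sumMap (f ∘ (false ∷_)) (allSubsets m) + sumMap (f ∘ (true ∷_)) (allSubsets m)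
sumMap-allSubsets {m} f =
  trans (sumMap-++ f (map (false ∷_) (allSubsets m)) (map (true ∷_) (allSubsets m)))
        (cong₂ _+_ (sumMap-map f (false ∷_) (allSubsets m)) (sumMap-map f (true ∷_) (allSubsets m)))

private
  cofacetsFrom : Subset m → List (Fin m) → List (Subset m)
  cofacetsFrom F js = map (λ j → F [ j ]≔ true) (filterᵇ (λ j → not (lookup F j)) js)

  cofacetsFrom-map-suc : (b : Bool) (F : Subset m) (js : List (Fin m)) →
    cofacetsFrom (b ∷ F) (map fsuc js) ≡ map (b ∷_) (cofacetsFrom F js)
  cofacetsFrom-map-suc b F [] = refl
  cofacetsFrom-map-suc b F (j ∷ js) with lookup F j
  ... | true = cofacetsFrom-map-suc b F js
  ... | false = cong ((b ∷ (F [ j ]≔ true)) ∷_) (cofacetsFrom-map-suc b F js)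

  cofacets-∷ : (b : Bool) (F : Subset m) →
    cofacetsFrom (b ∷ F) (List.tabulate fsuc) ≡ map (b ∷_) (cofacets F)
  cofacets-∷ {m} b F = trans (cong (cofacetsFrom (b ∷ F)) (sym (map-tabulate id fsuc)))
                             (cofacetsFrom-map-suc b F (allFin m))

cofacets-false∷ : (F : Subset m) → cofacets (false ∷ F) ≡ (true ∷ F) ∷ map (false ∷_) (cofacets F)
cofacets-false∷ F = cong ((true ∷ F) ∷_) (cofacets-∷ false F)

cofacets-true∷ : (F : Subset m) → cofacets (true ∷ F) ≡ map (true ∷_) (cofacets F)
cofacets-true∷ F = cofacets-∷ true F

∣cofacet∣≡suc∣F∣ : (F : Subset m) → All (λ G → ∣ G ∣ ≡ suc ∣ F ∣) (cofacets F)
∣cofacet∣≡suc∣F∣ [] = []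
∣cofacet∣≡suc∣F∣ (false ∷ F) rewrite cofacets-false∷ F = refl ∷ map⁺ (∣cofacet∣≡suc∣F∣ F)
∣cofacet∣≡suc∣F∣ (true ∷ F) rewrite cofacets-true∷ F = map⁺ (All.map (cong suc) (∣cofacet∣≡suc∣F∣ F))

sumMap-cofacets : (w : Subset m → ℕ) →
  sumMap (λ F → sumMap w (cofacets F)) (allSubsets m) ≡ sumMap (λ G → ∣ G ∣ * w G) (allSubsets m)
sumMap-cofacets {zero} w = refl
sumMap-cofacets {suc m} w = begin
  sumMap (λ F → sumMap w (cofacets F)) (allSubsets (suc m))
    ≡⟨ sumMap-allSubsets (λ F → sumMap w (cofacets F)) ⟩
  sumMap (λ F → sumMap w (cofacets (false ∷ F))) 𝒜 + sumMap (λ F → sumMap w (cofacets (true ∷ F))) 𝒜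
    ≡⟨ cong₂ _+_ (sumMap-cong (λ F → cong (sumMap w) (cofacets-false∷ F)) 𝒜)
                 (sumMap-cong (λ F → cong (sumMap w) (cofacets-true∷ F)) 𝒜) ⟩
  sumMap (λ F → w₁ F + sumMap w (map (false ∷_) (cofacets F))) 𝒜
    + sumMap (λ F → sumMap w (map (true ∷_) (cofacets F))) 𝒜
    ≡⟨ cong₂ _+_ (sumMap-cong (λ F → cong (w₁ F +_) (sumMap-map w (false ∷_) (cofacets F))) 𝒜)
                 (sumMap-cong (λ F → sumMap-map w (true ∷_) (cofacets F)) 𝒜) ⟩
  sumMap (λ F → w₁ F + sumMap w₀ (cofacets F)) 𝒜 + sumMap (λ F → sumMap w₁ (cofacets F)) 𝒜
    ≡⟨ cong (_+ sumMap (λ F → sumMap w₁ (cofacets F)) 𝒜) (sumMap-+ w₁ (λ F → sumMap w₀ (cofacets F)) 𝒜) ⟩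
  sumMap w₁ 𝒜 + sumMap (λ F → sumMap w₀ (cofacets F)) 𝒜 + sumMap (λ F → sumMap w₁ (cofacets F)) 𝒜
    ≡⟨ cong₂ (λ b c → sumMap w₁ 𝒜 + b + c) (sumMap-cofacets w₀) (sumMap-cofacets w₁) ⟩
  sumMap w₁ 𝒜 + sumMap (λ G → ∣ G ∣ * w₀ G) 𝒜 + sumMap (λ G → ∣ G ∣ * w₁ G) 𝒜
    ≡⟨ +-assoc (sumMap w₁ 𝒜) _ _ ⟩
  sumMap w₁ 𝒜 + (sumMap (λ G → ∣ G ∣ * w₀ G) 𝒜 + sumMap (λ G → ∣ G ∣ * w₁ G) 𝒜)
    ≡⟨ +-left-comm (sumMap w₁ 𝒜) (sumMap (λ G → ∣ G ∣ * w₀ G) 𝒜) _ ⟩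
  sumMap (λ G → ∣ G ∣ * w₀ G) 𝒜 + (sumMap w₁ 𝒜 + sumMap (λ G → ∣ G ∣ * w₁ G) 𝒜)
    ≡⟨ cong (sumMap (λ G → ∣ G ∣ * w₀ G) 𝒜 +_) (sumMap-+ w₁ (λ G → ∣ G ∣ * w₁ G) 𝒜) ⟨
  sumMap (λ G → ∣ false ∷ G ∣ * w₀ G) 𝒜 + sumMap (λ G → ∣ true ∷ G ∣ * w₁ G) 𝒜
    ≡⟨ sumMap-allSubsets (λ G → ∣ G ∣ * w G) ⟨
  sumMap (λ G → ∣ G ∣ * w G) (allSubsets (suc m)) ∎
  where
  open ≡-Reasoning
  𝒜 = allSubsets m
  w₀ w₁ : Subset m → ℕ
  w₀ G = w (false ∷ G)
  w₁ G = w (true ∷ G)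

chains : ℕ → Subset m → Subset m → ℕ
chains zero F E = if does (≡-dec _≟ᵇ_ E F) then 1 else 0
chains (suc i) F E = sumMap (λ G → chains i G E) (cofacets F)

sumMap-chains₀ : (E : Subset m) → sumMap (λ F → chains 0 F E) (allSubsets m) ≡ 1
sumMap-chains₀ [] = refl
-- ≡-dec compares heads first, so the half of the faces with the wrong head
-- contributes a sum of literal zeros.
sumMap-chains₀ {suc m} (b ∷ E) = trans (sumMap-allSubsets (λ F → chains 0 F (b ∷ E))) (split b)
  where
  split : (b : Bool) → sumMap (λ F → chains 0 (false ∷ F) (b ∷ E)) (allSubsets m)
                     + sumMap (λ F → chains 0 (true ∷ F) (b ∷ E)) (allSubsets m) ≡ 1
  split false = cong₂ _+_ (sumMap-chains₀ E) (sumMap-zero (allSubsets m))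
  split true = cong₂ _+_ (sumMap-zero (allSubsets m)) (sumMap-chains₀ E)

[∣F∣+i]*chains≡∣E∣*chains : (i : ℕ) (F E : Subset m) → (∣ F ∣ + i) * chains i F E ≡ ∣ E ∣ * chains i F E
[∣F∣+i]*chains≡∣E∣*chains zero F E with ≡-dec _≟ᵇ_ E F
... | yes refl = cong (_* 1) (+-identityʳ ∣ F ∣)
... | no _ = trans (*-zeroʳ (∣ F ∣ + 0)) (sym (*-zeroʳ ∣ E ∣))
[∣F∣+i]*chains≡∣E∣*chains (suc i) F E = begin
  (∣ F ∣ + suc i) * sumMap (λ G → chains i G E) (cofacets F)
    ≡⟨ sumMap-*ˡ (∣ F ∣ + suc i) (λ G → chains i G E) (cofacets F) ⟨
  sumMap (λ G → (∣ F ∣ + suc i) * chains i G E) (cofacets F)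
    ≡⟨ sumMap-cong-local (All.map step (∣cofacet∣≡suc∣F∣ F)) ⟩
  sumMap (λ G → ∣ E ∣ * chains i G E) (cofacets F)
    ≡⟨ sumMap-*ˡ ∣ E ∣ (λ G → chains i G E) (cofacets F) ⟩
  ∣ E ∣ * sumMap (λ G → chains i G E) (cofacets F) ∎
  where
  open ≡-Reasoning
  step : {G : Subset _} → ∣ G ∣ ≡ suc ∣ F ∣ → (∣ F ∣ + suc i) * chains i G E ≡ ∣ E ∣ * chains i G E
  step {G} ∣G∣≡ = trans (cong (_* chains i G E) (trans (+-suc ∣ F ∣ i) (cong (_+ i) (sym ∣G∣≡))))
                        ([∣F∣+i]*chains≡∣E∣*chains i G E)

chains-vanish : (i : ℕ) (F E : Subset m) → ∣ F ∣ + i ≢ ∣ E ∣ → chains i F E ≡ 0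
chains-vanish i F E ≢∣E∣ with chains i F E | [∣F∣+i]*chains≡∣E∣*chains i F E
... | zero | _ = refl
... | suc c | card = contradiction (*-cancelʳ-≡ (∣ F ∣ + i) ∣ E ∣ (suc c) card) ≢∣E∣

∣F∣*chains≡[∣E∣∸i]*chains : (i : ℕ) (F E : Subset m) → ∣ F ∣ * chains i F E ≡ (∣ E ∣ ∸ i) * chains i F E
∣F∣*chains≡[∣E∣∸i]*chains i F E with ∣ F ∣ + i ≟ ∣ E ∣
... | yes ∣F∣+i≡∣E∣ = cong (_* chains i F E) (trans (sym (m+n∸n≡m ∣ F ∣ i)) (cong (_∸ i) ∣F∣+i≡∣E∣))
... | no ≢∣E∣ rewrite chains-vanish i F E ≢∣E∣ = trans (*-zeroʳ ∣ F ∣) (sym (*-zeroʳ (∣ E ∣ ∸ i)))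

sumMap-chains : (i : ℕ) (E : Subset m) → sumMap (λ F → chains i F E) (allSubsets m) ≡ ∣ E ∣ P′ i
sumMap-chains zero E = sumMap-chains₀ E
sumMap-chains {m} (suc i) E = begin
  sumMap (λ F → sumMap (λ G → chains i G E) (cofacets F)) 𝒜
    ≡⟨ sumMap-cofacets (λ G → chains i G E) ⟩
  sumMap (λ G → ∣ G ∣ * chains i G E) 𝒜
    ≡⟨ sumMap-cong (λ G → ∣F∣*chains≡[∣E∣∸i]*chains i G E) 𝒜 ⟩
  sumMap (λ G → (∣ E ∣ ∸ i) * chains i G E) 𝒜
    ≡⟨ sumMap-*ˡ (∣ E ∣ ∸ i) (λ G → chains i G E) 𝒜 ⟩
  (∣ E ∣ ∸ i) * sumMap (λ G → chains i G E) 𝒜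
    ≡⟨ cong ((∣ E ∣ ∸ i) *_) (sumMap-chains i E) ⟩
  (∣ E ∣ ∸ i) * (∣ E ∣ P′ i) ∎
  where
  open ≡-Reasoning
  𝒜 = allSubsets m

sumMap-chains-bounded : (i b : ℕ) (E : Subset m) → ∣ E ∣ ≤ b →
  sumMap (λ F → chains i F E) (filter (λ F → ∣ F ∣ + i ≤? b) (allSubsets m)) ≡ ∣ E ∣ P′ i
sumMap-chains-bounded {m} i b E ∣E∣≤b =
  trans (sumMap-filter (λ F → ∣ F ∣ + i ≤? b) (λ F → chains i F E) (allSubsets m) vanish)
        (sumMap-chains i E)
  where
  vanish : (F : Subset m) → ¬ (∣ F ∣ + i ≤ b) → chains i F E ≡ 0
  vanish F ≰b = chains-vanish i F E (λ ≡∣E∣ → ≰b (subst (_≤ b) (sym ≡∣E∣) ∣E∣≤b))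

length-lam : ∀ {d n} (X : Family d n) (i : ℕ) (F : Subset (suc d)) →
  length (lam X i F) ≡ sumMap (λ x → chains i F (epsilon X x)) (unionList X)
length-lam X zero F = length-filter (λ x → ≡-dec _≟ᵇ_ (epsilon X x) F) (unionList X)
length-lam X (suc i) F = begin
  length (concatMap (lam X i) (cofacets F))
    ≡⟨ length-concatMap (lam X i) (cofacets F) ⟩
  sumMap (λ G → length (lam X i G)) (cofacets F)
    ≡⟨ sumMap-cong (length-lam X i) (cofacets F) ⟩
  sumMap (λ G → sumMap (λ x → chains i G (epsilon X x)) U) (cofacets F)
    ≡⟨ sumMap-swap (λ G x → chains i G (epsilon X x)) (cofacets F) U ⟩
  sumMap (λ x → sumMap (λ G → chains i G (epsilon X x)) (cofacets F)) U ∎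
  where
  open ≡-Reasoning
  U = unionList X

∣tabulate∣≡length-filterᵇ : (g : Fin m → A) (p : A → Bool) →
  ∣ tabulate (p ∘ g) ∣ ≡ length (filterᵇ p (List.tabulate g))
∣tabulate∣≡length-filterᵇ {zero} g p = refl
∣tabulate∣≡length-filterᵇ {suc m} g p with p (g fzero)
... | true = cong suc (∣tabulate∣≡length-filterᵇ (g ∘ fsuc) p)
... | false = ∣tabulate∣≡length-filterᵇ (g ∘ fsuc) p

2*k≤n⇒k≤n/2 : (k n : ℕ) → 2 * k ≤ n → k ≤ n / 2
2*k≤n⇒k≤n/2 k n 2k≤n = subst (_≤ n / 2) (m*n/n≡m k 2) (/-monoˡ-≤ 2 (subst (_≤ n) (*-comm 2 k) 2k≤n))

2*[m∸a]≤m : (a m : ℕ) → a ≤ m → m < 2 * a → 2 * (m ∸ a) ≤ m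
2*[m∸a]≤m a m a≤m m<2a = begin
  2 * (m ∸ a)         ≡⟨ cong ((m ∸ a) +_) (+-identityʳ (m ∸ a)) ⟩
  (m ∸ a) + (m ∸ a)   ≤⟨ +-monoʳ-≤ (m ∸ a) (<⇒≤ m∸a<a) ⟩
  (m ∸ a) + a         ≡⟨ m∸n+n≡m a≤m ⟩
  m                   ∎
  where
  open ≤-Reasoning
  m∸a<a : m ∸ a < a
  m∸a<a = +-cancelʳ-< a (m ∸ a) a
    (subst₂ _<_ (sym (m∸n+n≡m a≤m)) (cong (a +_) (+-identityʳ a)) m<2a)

∣smallerSide∣≤half : (p : Subset m) → ∣ (if 2 * ∣ p ∣ ≤ᵇ m then p else ∁ p) ∣ ≤ m / 2
∣smallerSide∣≤half {m} p with 2 * ∣ p ∣ ≤ᵇ m | ≤ᵇ-reflects-≤ (2 * ∣ p ∣) m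
... | true | ofʸ 2a≤m = 2*k≤n⇒k≤n/2 ∣ p ∣ m 2a≤m
... | false | ofⁿ 2a≰m = subst (_≤ m / 2) (sym (∣∁p∣≡n∸∣p∣ p))
  (2*k≤n⇒k≤n/2 (m ∸ ∣ p ∣) m (2*[m∸a]≤m ∣ p ∣ m (∣p∣≤n p) (≰⇒> 2a≰m)))

indicesContaining : ∀ {d n} → Family d n → Fin n → Subset (suc d)
indicesContaining X x = tabulate (λ i → lookup (X i) x)

deg≡∣indicesContaining∣ : ∀ {d n} (X : Family d n) (x : Fin n) → deg X x ≡ ∣ indicesContaining X x ∣
deg≡∣indicesContaining∣ X x = sym (∣tabulate∣≡length-filterᵇ id (λ i → lookup (X i) x))

tabulate-if-not : (c : Bool) (f : Fin m → Bool) →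
  tabulate (λ i → if c then f i else not (f i)) ≡ (if c then tabulate f else ∁ (tabulate f))
tabulate-if-not true f = refl
tabulate-if-not false f = tabulate-∘ not f

epsilon≡smallerSide : ∀ {d n} (X : Family d n) (x : Fin n) → let p = indicesContaining X x in
  epsilon X x ≡ (if 2 * ∣ p ∣ ≤ᵇ suc d then p else ∁ p)
epsilon≡smallerSide {d} X x =
  trans (cong (λ k → tabulate (λ i → if 2 * k ≤ᵇ suc d then f i else not (f i)))
              (deg≡∣indicesContaining∣ X x))
        (tabulate-if-not (2 * ∣ tabulate f ∣ ≤ᵇ suc d) f)
  where
  f : Fin (suc d) → Bool
  f i = lookup (X i) x

∣epsilon∣≤half : ∀ {d n} (X : Family d n) (x : Fin n) → ∣ epsilon X x ∣ ≤ suc d / 2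
∣epsilon∣≤half X x =
  subst (λ E → ∣ E ∣ ≤ _) (sym (epsilon≡smallerSide X x)) (∣smallerSide∣≤half (indicesContaining X x))

proposition3p4 : (d n : ℕ) (X : Family d n) (i : ℕ) →
    Vol X i ≡ evalAt1 (derivN i (vpoly X))
proposition3p4 d n X i = begin
  sumMap (λ F → length (lam X i F)) faces
    ≡⟨ sumMap-cong (length-lam X i) faces ⟩
  sumMap (λ F → sumMap (λ x → chains i F (epsilon X x)) U) faces
    ≡⟨ sumMap-swap (λ F x → chains i F (epsilon X x)) faces U ⟩
  sumMap (λ x → sumMap (λ F → chains i F (epsilon X x)) faces) U
    ≡⟨ sumMap-cong (λ x → sumMap-chains-bounded i (suc d / 2) (epsilon X x) (∣epsilon∣≤half X x)) U ⟩
  sumMap (λ x → ∣ epsilon X x ∣ P′ i) U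
    ≡⟨ evalAt1-derivN-sumMonomials (λ x → ∣ epsilon X x ∣) i U ⟨
  evalAt1 (derivN i (vpoly X)) ∎
  where
  open ≡-Reasoning
  U = unionList X
  faces = filter (λ F → ∣ F ∣ + i ≤? suc d / 2) (allSubsets (suc d))
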